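{- A connected graph $G$ is thrifty if and only if $w(G)=1$.
   Context: A pebbling distribution assigns to each vertex $v$ a non-negative integer $D(v)$ of pebbles; a rooted distribution fixes a root $r$. A pebbling step $[a,b]$, for adjacent $a,b$, removes two pebbles from $a$ and adds one to $b$; it is greedy if $d(a,r)>d(b,r)$ ($d$ = graph distance). A rooted distribution is $r$-solvable if some sequence of pebbling steps (a solution) ends with at least one pebble on $r$; it is $r$-critical if it is $r$-solvable but removing any single pebble makes it not $r$-solvable; it is greedy if it has a solution using only greedy steps. $c_r(G)$ is the largest size of an $r$-critical rooted distribution on $G$ over all roots $r$; an $r$-ceiling distribution is an $r$-critical rooted distribution (any root) with exactly $c_r(G)$ pebbles. $G$ is thrifty if every $r$-ceiling distribution on $G$ is greedy. The weight of a rooted distribution is $w(D)=\sum_v D(v)/2^{d(v,r)}$, and $w(G)$ is the largest weight of an $r$-ceiling distribution on $G$. -}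

module Defs where

open import Data.Bool using (Bool; true; false; T; _∧_; _∨_; if_then_else_)
open import Data.Nat using (ℕ; zero; suc; _+_; _∸_; _^_; _≤_; _<_)
open import Data.Nat.Properties using (m^n≢0)
open import Data.Fin using (Fin; _≟_)
open import Data.Vec using (Vec; lookup; _[_]%=_; foldr; zipWith; allFin) renaming (map to vmap)
import Data.List as L
open import Data.Bool.ListAction using (any)
open import Data.Integer using (+_)
open import Data.Rational using (ℚ; _/_; 0ℚ) renaming (_+_ to _+ℚ_; _≤_ to _≤ℚ_)
open import Data.Product using (Σ; _×_; ∃)
open import Relation.Nullary using (¬_; ⌊_⌋)
open import Relation.Binary.PropositionalEquality using (_≡_)

record Graph : Set where
  field
    n     : ℕ
    adj   : Fin n → Fin n → Bool
    sym   : ∀ u v → adj u v ≡ adj v u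
    irref : ∀ v → adj v v ≡ false

module _ (G : Graph) where
  open Graph G

  Adj : Fin n → Fin n → Set
  Adj u v = T (adj u v)

  data Walk : Fin n → Fin n → Set where
    [] : ∀ {v} → Walk v v
    _∷_ : ∀ {u w v} → Adj u w → Walk w v → Walk u v

  Connected : Set
  Connected = Fin n × (∀ u v → Walk u v)

  reach : ℕ → Fin n → Fin n → Bool
  reach zero    u v = ⌊ u ≟ v ⌋
  reach (suc k) u v = reach k u v ∨ any (λ w → reach k u w ∧ adj w v) (L.allFin n)

  search : (ℕ → Bool) → ℕ → ℕ → ℕ
  search f k zero       = k
  search f k (suc fuel) = if f k then k else search f (suc k) fuel

  -- graph distance d(u,v) (correct for connected graphs:
  -- the least k ≤ n such that there is a walk of length ≤ k)
  dist : Fin n → Fin n → ℕ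
  dist u v = search (λ k → reach k u v) 0 n

  Distribution : Set
  Distribution = Vec ℕ n

  size : Distribution → ℕ
  size D = foldr (λ _ → ℕ) _+_ 0 D

  move : Fin n → Fin n → Distribution → Distribution
  move a b D = (D [ a ]%= (λ x → x ∸ 2)) [ b ]%= suc

  data Solvable (greedyOnly : Bool) (r : Fin n) : Distribution → Set where
    done : ∀ {D} → 1 ≤ lookup D r → Solvable greedyOnly r D
    step : ∀ {D} (a b : Fin n) → Adj a b → 2 ≤ lookup D a →
           (T greedyOnly → dist b r < dist a r) →
           Solvable greedyOnly r (move a b D) → Solvable greedyOnly r D

  RSolvable : Fin n → Distribution → Set
  RSolvable = Solvable false

  Greedy : Fin n → Distribution → Set
  Greedy = Solvable true

  removePebble : Fin n → Distribution → Distribution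
  removePebble v D = D [ v ]%= (λ x → x ∸ 1)

  Critical : Fin n → Distribution → Set
  Critical r D = RSolvable r D ×
    (∀ v → 1 ≤ lookup D v → ¬ RSolvable r (removePebble v D))

  -- r-ceiling distribution: r-critical with the maximum size c_r(G)
  -- among all critical rooted distributions (over all roots)
  Ceiling : Fin n → Distribution → Set
  Ceiling r D = Critical r D × (∀ r' D' → Critical r' D' → size D' ≤ size D)

  Thrifty : Set
  Thrifty = ∀ r D → Ceiling r D → Greedy r D

  weight : Fin n → Distribution → ℚ
  weight r D = foldr (λ _ → ℚ) _+ℚ_ 0ℚ
    (zipWith (λ v x → _/_ (+ x) (2 ^ dist v r) {{m^n≢0 2 (dist v r)}}) (allFin n) D)

  WeightOfGraphIs : ℚ → Set
  WeightOfGraphIs q =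
    (Σ (Fin n) λ r → Σ Distribution λ D → Ceiling r D × weight r D ≡ q) ×
    (∀ r D → Ceiling r D → weight r D ≤ℚ q)

-- Scale the weight by 2^n: the potential P(D) = Σ_v D(v)·2^(n − d(v,r)) equals 2^n·w(D). A step
-- [a,b] removes 2·2^(n − d(a,r)) and adds 2^(n − d(b,r)); since d(a,r) ≤ d(b,r) + 1, no step
-- increases P, greedy steps keep it fixed and non-greedy steps decrease it strictly. A pebble on r
-- alone contributes 2^n, so every solvable distribution has weight at least 1, and a solvable
-- distribution of weight at most 1 admits no non-greedy step anywhere in a solution: if w(G) = 1,
-- then G is thrifty. Conversely, tracing a greedy solution backwards and keeping only the pebbles it
-- actually uses yields a solvable sub-distribution of weight at most 1; a critical distribution
-- coincides with each of its solvable sub-distributions, so in a thrifty graph every ceiling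
-- distribution has weight exactly 1. Ceiling distributions exist because an r-critical distribution
-- has at most 2^ℓ pebbles on a vertex joined to r by a walk of length ℓ, leaving finitely many
-- candidates.
module Submission where

open import Algebra.Properties.CommutativeSemigroup as CommSemigroup using ()
open import Data.Bool using (Bool; true; false; T; _∧_)
open import Data.Bool.Properties using (T-∨; T-∧)
open import Data.Empty using (⊥-elim)
open import Data.Fin using (Fin; _≟_) renaming (zero to fzero; suc to fsuc)
open import Data.Fin.Properties using (any?; all?)
open import Data.Integer as ℤ using (+≤+; 0ℤ; 1ℤ)
open import Data.Integer.Properties as ℤ using (pos-*; pos-+; drop‿+≤+)
open import Data.Integer.Tactic.RingSolver as ℤ-Solver using ()
open import Data.List as List using (List; upTo; cartesianProductWith)
open import Data.List.Extrema.Nat using (argmax; argmax-all; f[xs]≤f[argmax])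
open import Data.List.Membership.Propositional using (_∈_; lose)
open import Data.List.Membership.Propositional.Properties
  using (∈-upTo⁺; ∈-cartesianProductWith⁺; ∈-allFin; ∈-map⁺; ∈-concat⁺′; ∈-filter⁺)
open import Data.List.Relation.Unary.All as All using ()
open import Data.List.Relation.Unary.All.Properties using (all-filter)
open import Data.List.Relation.Unary.Any using (here; satisfied)
open import Data.List.Relation.Unary.Any.Properties using (any⁺; any⁻)
open import Data.Nat
  using (ℕ; zero; suc; _+_; _*_; _∸_; _^_; _≤_; _<_; _≤?_; _<?_; z≤n; s≤s; s≤s⁻¹; NonZero; >-nonZero)
open import Data.Nat.Properties renaming (_≟_ to _≟ℕ_)
open import Data.Nat.Tactic.RingSolver using (solve-∀)
open import Data.Product using (Σ; _×_; _,_; proj₁; proj₂)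
open import Data.Rational as ℚ using (ℚ; 0ℚ; 1ℚ; toℚᵘ)
open import Data.Rational.Properties
  using (toℚᵘ-fromℚᵘ; toℚᵘ-homo-+; toℚᵘ-mono-≤; toℚᵘ-cancel-≤; toℚᵘ-injective)
open import Data.Rational.Unnormalised as ℚᵘ
  using (ℚᵘ; mkℚᵘ; *≡*; *≤*; 1ℚᵘ) renaming (_≃_ to _≃ᵘ_)
open import Data.Rational.Unnormalised.Properties as ℚᵘ using (*-cancelʳ-/; /-cong; ↥[n/d]≡n)
  renaming (≃-trans to ≃ᵘ-trans; ≃-sym to ≃ᵘ-sym; ≃-reflexive to ≃ᵘ-reflexive)
open import Data.Sum using (_⊎_; inj₁; inj₂; map₂)
open import Data.Vec using (Vec; []; _∷_; lookup; _[_]%=_; replicate; tabulate; foldr; zipWith)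
open import Data.Vec.Properties
  using ( lookup∘tabulate; lookup∘updateAt; lookup∘updateAt′; lookup-replicate
        ; updateAt-updateAt; updateAt-id-local)
open import Data.Vec.Relation.Binary.Pointwise.Extensional using (Pointwise; ext; head; tail)
open import Function using (_∘_; id)
open import Function.Bundles using (_⇔_; mk⇔; Equivalence)
open import Relation.Binary.PropositionalEquality
open import Relation.Nullary using (Dec; yes; no)
open import Relation.Nullary.Decidable using (toWitness; fromWitness; T?; map′; _×-dec_; _→-dec_; ¬?)

open import Defs

open Pointwise using (app)

private variable m : ℕ

-- Pointwise order and weighted sums on vectors of naturals

infix 4 _≤ᵥ_

_≤ᵥ_ : Vec ℕ m → Vec ℕ m → Set
_≤ᵥ_ = Pointwise _≤_

weightedSum : (Fin m → ℕ) → Vec ℕ m → ℕ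
weightedSum w []      = 0
weightedSum w (x ∷ D) = x * w fzero + weightedSum (w ∘ fsuc) D

weightedSum-updateAt-+ : ∀ w (D : Vec ℕ m) i k →
  weightedSum w (D [ i ]%= (k +_)) ≡ k * w i + weightedSum w D
weightedSum-updateAt-+ w (x ∷ D) fzero k =
  +-*-rearrange k x (w fzero) (weightedSum (w ∘ fsuc) D)
  where
  +-*-rearrange : ∀ k x p s → (k + x) * p + s ≡ k * p + (x * p + s)
  +-*-rearrange = solve-∀
weightedSum-updateAt-+ w (x ∷ D) (fsuc i) k = trans
  (cong (x * w fzero +_) (weightedSum-updateAt-+ (w ∘ fsuc) D i k))
  (+-left-comm (x * w fzero) (k * w (fsuc i)) _)
  where open CommSemigroup +-commutativeSemigroup using () renaming (x∙yz≈y∙xz to +-left-comm)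

weightedSum-updateAt-∸ : ∀ w (D : Vec ℕ m) i {k} → k ≤ lookup D i →
  k * w i + weightedSum w (D [ i ]%= (_∸ k)) ≡ weightedSum w D
weightedSum-updateAt-∸ w D i {k} k≤Dᵢ = begin
  k * w i + weightedSum w (D [ i ]%= (_∸ k))
    ≡⟨ weightedSum-updateAt-+ w (D [ i ]%= (_∸ k)) i k ⟨
  weightedSum w (D [ i ]%= (_∸ k) [ i ]%= (k +_))
    ≡⟨ cong (weightedSum w) (updateAt-updateAt i D) ⟩
  weightedSum w (D [ i ]%= (λ x → k + (x ∸ k)))
    ≡⟨ cong (weightedSum w) (updateAt-id-local i D (m+[n∸m]≡n k≤Dᵢ)) ⟩
  weightedSum w D ∎
  where open ≡-Reasoning

weightedSum-transfer : ∀ w (D : Vec ℕ m) i j {k} l → k ≤ lookup D i →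
  weightedSum w (D [ i ]%= (_∸ k) [ j ]%= (l +_)) + k * w i ≡ weightedSum w D + l * w j
weightedSum-transfer w D i j {k} l k≤Dᵢ = begin
  weightedSum w (D′ [ j ]%= (l +_)) + k * w i ≡⟨ cong (_+ k * w i) (weightedSum-updateAt-+ w D′ j l) ⟩
  l * w j + weightedSum w D′ + k * w i       ≡⟨ +-rearrange (l * w j) (weightedSum w D′) (k * w i) ⟩
  (k * w i + weightedSum w D′) + l * w j     ≡⟨ cong (_+ l * w j) (weightedSum-updateAt-∸ w D i k≤Dᵢ) ⟩
  weightedSum w D + l * w j                  ∎
  where
  open ≡-Reasoning
  D′ : Vec ℕ _
  D′ = D [ i ]%= (_∸ k)
  +-rearrange : ∀ x y z → x + y + z ≡ (z + y) + x
  +-rearrange = solve-∀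

weightedSum-mono : ∀ w {D E : Vec ℕ m} → D ≤ᵥ E → weightedSum w D ≤ weightedSum w E
weightedSum-mono w {[]}    {[]}    _   = z≤n
weightedSum-mono w {_ ∷ _} {_ ∷ _} D≤E =
  +-mono-≤ (*-monoˡ-≤ (w fzero) (head D≤E)) (weightedSum-mono (w ∘ fsuc) (tail D≤E))

lookup*≤weightedSum : ∀ w (D : Vec ℕ m) i → lookup D i * w i ≤ weightedSum w D
lookup*≤weightedSum w (x ∷ D) fzero    = m≤m+n _ _
lookup*≤weightedSum w (x ∷ D) (fsuc i) = ≤-trans (lookup*≤weightedSum (w ∘ fsuc) D i) (m≤n+m _ _)

weightedSum-replicate-0 : ∀ w → weightedSum w (replicate m 0) ≡ 0
weightedSum-replicate-0 {zero}  w = refl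
weightedSum-replicate-0 {suc m} w = weightedSum-replicate-0 (w ∘ fsuc)

module _ {A : Set} {i j : Fin m} (i≢j : i ≢ j) (f g : A → A) (xs : Vec A m) where

  lookup∘updateAt₂ˡ : lookup (xs [ i ]%= f [ j ]%= g) i ≡ f (lookup xs i)
  lookup∘updateAt₂ˡ = trans (lookup∘updateAt′ i j i≢j (xs [ i ]%= f)) (lookup∘updateAt i xs)

  lookup∘updateAt₂ʳ : lookup (xs [ i ]%= f [ j ]%= g) j ≡ g (lookup xs j)
  lookup∘updateAt₂ʳ =
    trans (lookup∘updateAt j (xs [ i ]%= f)) (cong g (lookup∘updateAt′ j i (i≢j ∘ sym) xs))

lookup∘updateAt₂′ : ∀ {A : Set} {i j v : Fin m} {f g : A → A} (xs : Vec A m) → v ≢ i → v ≢ j →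
                    lookup (xs [ i ]%= f [ j ]%= g) v ≡ lookup xs v
lookup∘updateAt₂′ {i = i} {j} {v} {f} xs v≢i v≢j =
  trans (lookup∘updateAt′ v j v≢j (xs [ i ]%= f)) (lookup∘updateAt′ v i v≢i xs)

≤ᵥ-cases : ∀ {i j : Fin m} {D E : Vec ℕ m} → lookup D i ≤ lookup E i → lookup D j ≤ lookup E j →
           (∀ v → v ≢ i → v ≢ j → lookup D v ≤ lookup E v) → D ≤ᵥ E
≤ᵥ-cases {i = i} {j} {D} {E} Dᵢ≤Eᵢ Dⱼ≤Eⱼ D≤E = ext by-cases
  where
  by-cases : ∀ v → lookup D v ≤ lookup E v
  by-cases v with v ≟ i | v ≟ j
  ... | yes refl | _        = Dᵢ≤Eᵢ
  ... | no _     | yes refl = Dⱼ≤Eⱼ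
  ... | no v≢i   | no v≢j   = D≤E v v≢i v≢j

updateAt-mono : ∀ {D E : Vec ℕ m} i {f : ℕ → ℕ} → (∀ {x y} → x ≤ y → f x ≤ f y) →
                D ≤ᵥ E → D [ i ]%= f ≤ᵥ E [ i ]%= f
updateAt-mono {D = D} {E} i {f} f-mono (ext D≤E) = ≤ᵥ-cases {i = i} {i} at-i at-i
  (λ v v≢i _ → subst₂ _≤_ (sym (lookup∘updateAt′ v i v≢i D)) (sym (lookup∘updateAt′ v i v≢i E))
                (D≤E v))
  where
  at-i : lookup (D [ i ]%= f) i ≤ lookup (E [ i ]%= f) i
  at-i = subst₂ _≤_ (sym (lookup∘updateAt i D)) (sym (lookup∘updateAt i E)) (f-mono (D≤E i))

boundedVecs : Vec ℕ m → List (Vec ℕ m)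
boundedVecs []      = [] List.∷ List.[]
boundedVecs (b ∷ B) = cartesianProductWith _∷_ (upTo (suc b)) (boundedVecs B)

∈-boundedVecs : ∀ {B D : Vec ℕ m} → D ≤ᵥ B → D ∈ boundedVecs B
∈-boundedVecs {B = []}    {[]}    _   = here refl
∈-boundedVecs {B = _ ∷ _} {_ ∷ _} D≤B =
  ∈-cartesianProductWith⁺ _∷_ (∈-upTo⁺ (s≤s (head D≤B))) (∈-boundedVecs (tail D≤B))

-- Dyadic fractions

infixl 7 _/2^_ _/ᵘ2^_

_/2^_ : ℕ → ℕ → ℚ
x /2^ k = (ℤ.+ x ℚ./ 2 ^ k) {{m^n≢0 2 k}}

_/ᵘ2^_ : ℕ → ℕ → ℚᵘ
x /ᵘ2^ k = (ℤ.+ x ℚᵘ./ 2 ^ k) {{m^n≢0 2 k}}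

toℚᵘ-/ : ∀ x d .{{_ : NonZero d}} → toℚᵘ (ℤ.+ x ℚ./ d) ≃ᵘ ℤ.+ x ℚᵘ./ d
toℚᵘ-/ x (suc d) = toℚᵘ-fromℚᵘ (mkℚᵘ (ℤ.+ x) d)

/-+-/ : ∀ x y d .{{_ : NonZero d}} → x ℚᵘ./ d ℚᵘ.+ y ℚᵘ./ d ≃ᵘ (x ℤ.+ y) ℚᵘ./ d
/-+-/ x y (suc d) = *≡* (+-over-common-denominator x y (ℤ.+ suc d))
  where
  +-over-common-denominator : ∀ x y q → (x ℤ.* q ℤ.+ y ℤ.* q) ℤ.* q ≡ (x ℤ.+ y) ℤ.* (q ℤ.* q)
  +-over-common-denominator = ℤ-Solver.solve-∀

/-rescale : ∀ x {d c N} .{{_ : NonZero d}} .{{_ : NonZero N}} → d * c ≡ N →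
            ℤ.+ x ℚᵘ./ d ≃ᵘ ℤ.+ (x * c) ℚᵘ./ N
/-rescale x {d} {c} refl =
  ≃ᵘ-sym (≃ᵘ-trans (≃ᵘ-reflexive (/-cong (pos-* x c) refl)) (*-cancelʳ-/ c {ℤ.+ x} {d}))

/≤1⇔ : ∀ x d .{{_ : NonZero d}} → ℤ.+ x ℚᵘ./ d ℚᵘ.≤ 1ℚᵘ ⇔ x ≤ d
/≤1⇔ x (suc d) = mk⇔
  (λ { (*≤* x*1≤1*d) → drop‿+≤+ (subst₂ ℤ._≤_ x*1≡x 1*d≡d x*1≤1*d) })
  (λ x≤d → *≤* (subst₂ ℤ._≤_ (sym x*1≡x) (sym 1*d≡d) (+≤+ x≤d)))
  where
  x*1≡x : ℤ.+ x ℤ.* 1ℤ ≡ ℤ.+ x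
  x*1≡x = ℤ.*-identityʳ (ℤ.+ x)
  1*d≡d : 1ℤ ℤ.* ℤ.+ suc d ≡ ℤ.+ suc d
  1*d≡d = ℤ.*-identityˡ (ℤ.+ suc d)

d/d≃1 : ∀ d .{{_ : NonZero d}} → ℤ.+ d ℚᵘ./ d ≃ᵘ 1ℚᵘ
d/d≃1 (suc d) = *≡* (trans (ℤ.*-identityʳ (ℤ.+ suc d)) (sym (ℤ.*-identityˡ (ℤ.+ suc d))))

-- Stated for `tabulate f` rather than `allFin` so that the induction on D goes through.
fractionSum≃ : ∀ N {m k} (δ : Fin k → ℕ) (f : Fin m → Fin k) → (∀ v → δ v ≤ N) →
               (D : Vec ℕ m) →
  toℚᵘ (foldr (λ _ → ℚ) ℚ._+_ 0ℚ (zipWith (λ v x → x /2^ δ v) (tabulate f) D))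
    ≃ᵘ weightedSum (λ i → 2 ^ (N ∸ δ (f i))) D /ᵘ2^ N
fractionSum≃ N δ f δ≤N []      = *≡* (sym (cong (ℤ._* 1ℤ) (↥[n/d]≡n 0ℤ (2 ^ N) {{m^n≢0 2 N}})))
fractionSum≃ N δ f δ≤N (x ∷ D) = begin
  toℚᵘ (x /2^ d ℚ.+ rest)
    ≈⟨ toℚᵘ-homo-+ (x /2^ d) rest ⟩
  toℚᵘ (x /2^ d) ℚᵘ.+ toℚᵘ rest
    ≈⟨ ℚᵘ.+-cong (toℚᵘ-/ x (2 ^ d)) (fractionSum≃ N δ (f ∘ fsuc) δ≤N D) ⟩
  x /ᵘ2^ d ℚᵘ.+ weightedSum w′ D /ᵘ2^ N
    ≈⟨ ℚᵘ.+-congˡ _ (/-rescale x split) ⟩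
  (x * 2 ^ (N ∸ d)) /ᵘ2^ N ℚᵘ.+ weightedSum w′ D /ᵘ2^ N
    ≈⟨ /-+-/ _ _ (2 ^ N) ⟩
  (ℤ.+ (x * 2 ^ (N ∸ d)) ℤ.+ ℤ.+ weightedSum w′ D) ℚᵘ./ 2 ^ N
    ≈⟨ ≃ᵘ-reflexive (/-cong (sym (pos-+ (x * 2 ^ (N ∸ d)) _)) refl) ⟩
  (x * 2 ^ (N ∸ d) + weightedSum w′ D) /ᵘ2^ N ∎
  where
  open ℚᵘ.≃-Reasoning
  d : ℕ
  d = δ (f fzero)
  w′ : Fin _ → ℕ
  w′ i = 2 ^ (N ∸ δ (f (fsuc i)))
  rest : ℚ
  rest = foldr (λ _ → ℚ) ℚ._+_ 0ℚ (zipWith (λ v x → x /2^ δ v) (tabulate (f ∘ fsuc)) D)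
  instance
    2^d≢0 : NonZero (2 ^ d)
    2^d≢0 = m^n≢0 2 d
    2^N≢0 : NonZero (2 ^ N)
    2^N≢0 = m^n≢0 2 N
  split : 2 ^ d * 2 ^ (N ∸ d) ≡ 2 ^ N
  split = trans (sym (^-distribˡ-+-* 2 d (N ∸ d))) (cong (2 ^_) (m+[n∸m]≡n (δ≤N (f fzero))))

≤1ℚ⇔ : ∀ q x N → toℚᵘ q ≃ᵘ x /ᵘ2^ N → q ℚ.≤ 1ℚ ⇔ x ≤ 2 ^ N
≤1ℚ⇔ q x N q≃x/2^N = mk⇔
  (λ q≤1 → Equivalence.to x/2^N≤1⇔ (ℚᵘ.≤-respˡ-≃ q≃x/2^N (toℚᵘ-mono-≤ q≤1)))
  (λ x≤2^N → toℚᵘ-cancel-≤ (ℚᵘ.≤-respˡ-≃ (≃ᵘ-sym q≃x/2^N) (Equivalence.from x/2^N≤1⇔ x≤2^N)))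
  where
  x/2^N≤1⇔ : x /ᵘ2^ N ℚᵘ.≤ 1ℚᵘ ⇔ x ≤ 2 ^ N
  x/2^N≤1⇔ = /≤1⇔ x (2 ^ N) {{m^n≢0 2 N}}

≡1ℚ : ∀ q N → toℚᵘ q ≃ᵘ 2 ^ N /ᵘ2^ N → q ≡ 1ℚ
≡1ℚ q N q≃1 = toℚᵘ-injective (≃ᵘ-trans q≃1 (d/d≃1 (2 ^ N) {{m^n≢0 2 N}}))

module Distance (G : Graph) where
  open Graph G using (n; adj)

  search-≤ : ∀ f k fuel → search G f k fuel ≤ k + fuel
  search-≤ f k zero       = m≤m+n k 0
  search-≤ f k (suc fuel) with f k
  ... | true  = m≤m+n k _
  ... | false = ≤-trans (search-≤ f (suc k) fuel) (≤-reflexive (sym (+-suc k fuel)))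

  search-found : ∀ f k fuel → T (f (search G f k fuel)) ⊎ search G f k fuel ≡ k + fuel
  search-found f k zero       = inj₂ (sym (+-identityʳ k))
  search-found f k (suc fuel) with f k in fk
  ... | true  = inj₁ (subst T (sym fk) _)
  ... | false with search-found f (suc k) fuel
  ...   | inj₁ found = inj₁ found
  ...   | inj₂ exhausted = inj₂ (trans exhausted (sym (+-suc k fuel)))

  search-least : ∀ f k fuel {j} → k ≤ j → j ≤ k + fuel → T (f j) → search G f k fuel ≤ j
  search-least f k zero       k≤j _ _ = k≤j
  search-least f k (suc fuel) {j} k≤j j≤k+fuel fj with f k in fk
  ... | true  = k≤j
  ... | false with k ≟ℕ j
  ...   | yes refl = ⊥-elim (subst T fk fj)
  ...   | no  k≢j  =
    search-least f (suc k) fuel (≤∧≢⇒< k≤j k≢j) (≤-trans j≤k+fuel (≤-reflexive (+-suc k fuel))) fj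

  reach-weaken : ∀ k {u v} → T (reach G k u v) → T (reach G (suc k) u v)
  reach-weaken k {u} {v} = Equivalence.from (T-∨ {reach G k u v}) ∘ inj₁

  reach-snoc : ∀ k {u w v} → T (reach G k u w) → Adj G w v → T (reach G (suc k) u v)
  reach-snoc k {u} {w} {v} u⇝w w~v = Equivalence.from (T-∨ {reach G k u v})
    (inj₂ (any⁺ _ (lose (∈-allFin w) (Equivalence.from T-∧ (u⇝w , w~v)))))

  reach-suc⁻ : ∀ k {u v} → T (reach G (suc k) u v) →
               T (reach G k u v) ⊎ Σ (Fin n) λ w → T (reach G k u w) × Adj G w v
  reach-suc⁻ k {u} {v} u⇝v = map₂ (λ via → let w , t = satisfied via in w , Equivalence.to T-∧ t)
    (map₂ (any⁻ (λ w → reach G k u w ∧ adj w v) (List.allFin n))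
      (Equivalence.to (T-∨ {reach G k u v}) u⇝v))

  reach-∷ : ∀ {a b} → Adj G a b → ∀ k v → T (reach G k b v) → T (reach G (suc k) a v)
  reach-∷ a~b zero    v b≟v with refl ← toWitness b≟v = reach-snoc 0 (fromWitness refl) a~b
  reach-∷ a~b (suc k) v b⇝v with reach-suc⁻ k b⇝v
  ... | inj₁ b⇝v′           = reach-weaken (suc k) (reach-∷ a~b k v b⇝v′)
  ... | inj₂ (w , b⇝w , w~v) = reach-snoc (suc k) (reach-∷ a~b k w b⇝w) w~v

  dist≤n : ∀ u v → dist G u v ≤ n
  dist≤n u v = search-≤ (λ k → reach G k u v) 0 n

  dist-refl : ∀ r → dist G r r ≡ 0
  dist-refl r = n≤0⇒n≡0 (search-least (λ k → reach G k r r) 0 n z≤n z≤n (fromWitness refl))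

  -- `dist` saturates at n when there is no walk, so no connectivity is needed here.
  dist-step : ∀ {a b} r → Adj G a b → dist G a r ≤ suc (dist G b r)
  dist-step {a} {b} r a~b with search-found (λ k → reach G k b r) 0 n | suc (dist G b r) ≤? n
  ... | inj₁ b⇝r | yes 1+d≤n =
    search-least (λ k → reach G k a r) 0 n z≤n 1+d≤n (reach-∷ a~b (dist G b r) r b⇝r)
  ... | inj₁ _   | no  1+d≰n = ≤-trans (dist≤n a r) (<⇒≤ (≰⇒> 1+d≰n))
  ... | inj₂ d≡n | _         = ≤-trans (dist≤n a r) (≤-trans (≤-reflexive (sym d≡n)) (n≤1+n _))

-- Pebbling potential

o≤1+n⇒m∸n≤1+m∸o : ∀ m {n o} → o ≤ suc n → m ∸ n ≤ suc (m ∸ o)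
o≤1+n⇒m∸n≤1+m∸o m       {n}     {zero}  _         = ≤-trans (m∸n≤m m n) (n≤1+n m)
o≤1+n⇒m∸n≤1+m∸o zero    {n}     {suc o} _         = ≤-trans (≤-reflexive (0∸n≡0 n)) z≤n
o≤1+n⇒m∸n≤1+m∸o (suc m) {zero}  {suc o} (s≤s z≤n) = ≤-refl
o≤1+n⇒m∸n≤1+m∸o (suc m) {suc n} {suc o} (s≤s o≤n) = o≤1+n⇒m∸n≤1+m∸o m o≤n

module Pebbling (G : Graph) where
  open Graph G using (n; irref)
  open Distance G

  private variable
    a b r : Fin n
    D E : Distribution G
    greedyOnly : Bool

  adj⇒≢ : Adj G a b → a ≢ b
  adj⇒≢ {a} a~a refl = subst T (irref a) a~a

  lookup-move-src : ∀ D → Adj G a b → lookup (move G a b D) a ≡ lookup D a ∸ 2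
  lookup-move-src D a~b = lookup∘updateAt₂ˡ (adj⇒≢ a~b) (_∸ 2) suc D

  lookup-move-tgt : ∀ D → Adj G a b → lookup (move G a b D) b ≡ suc (lookup D b)
  lookup-move-tgt D a~b = lookup∘updateAt₂ʳ (adj⇒≢ a~b) (_∸ 2) suc D

  lookup-move-other : ∀ D {v} → v ≢ a → v ≢ b → lookup (move G a b D) v ≡ lookup D v
  lookup-move-other D = lookup∘updateAt₂′ D

  move-mono : D ≤ᵥ E → move G a b D ≤ᵥ move G a b E
  move-mono {a = a} {b} = updateAt-mono b s≤s ∘ updateAt-mono a (∸-monoˡ-≤ 2)

  solvable-mono : D ≤ᵥ E → Solvable G greedyOnly r D → Solvable G greedyOnly r E
  solvable-mono {r = r} D≤E (done 1≤Dᵣ) = done (≤-trans 1≤Dᵣ (app D≤E r))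
  solvable-mono D≤E (step a b a~b 2≤Dₐ greedy s) =
    step a b a~b (≤-trans 2≤Dₐ (app D≤E a)) greedy (solvable-mono (move-mono D≤E) s)

  exponent : Fin n → Fin n → ℕ
  exponent r v = n ∸ dist G v r

  exponent-root : exponent r r ≡ n
  exponent-root {r} = cong (n ∸_) (dist-refl r)

  exponent-step : Adj G a b → exponent r b ≤ suc (exponent r a)
  exponent-step {r = r} a~b = o≤1+n⇒m∸n≤1+m∸o n (dist-step r a~b)

  exponent-greedy : dist G b r < dist G a r → suc (exponent r a) ≤ exponent r b
  exponent-greedy {r = r} {a = a} b<a =
    ≤-trans (≤-reflexive (sym (+-∸-assoc 1 (dist≤n a r)))) (∸-monoʳ-≤ (suc n) b<a)

  exponent-nongreedy : dist G a r ≤ dist G b r → exponent r b ≤ exponent r a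
  exponent-nongreedy = ∸-monoʳ-≤ n

  potential : Fin n → Distribution G → ℕ
  potential r = weightedSum (λ v → 2 ^ exponent r v)

  weight≃potential : ∀ r D → toℚᵘ (weight G r D) ≃ᵘ potential r D /ᵘ2^ n
  weight≃potential r = fractionSum≃ n (λ v → dist G v r) id (λ v → dist≤n v r)

  weight≤1⇔potential≤2^n : ∀ r D → weight G r D ℚ.≤ 1ℚ ⇔ potential r D ≤ 2 ^ n
  weight≤1⇔potential≤2^n r D = ≤1ℚ⇔ (weight G r D) _ n (weight≃potential r D)

  potential≡2^n⇒weight≡1 : ∀ r D → potential r D ≡ 2 ^ n → weight G r D ≡ 1ℚ
  potential≡2^n⇒weight≡1 r D pot≡2^n =
    ≡1ℚ (weight G r D) n
      (subst (λ x → toℚᵘ (weight G r D) ≃ᵘ x /ᵘ2^ n) pot≡2^n (weight≃potential r D))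

  potential-move : ∀ r D a b → 2 ≤ lookup D a →
    potential r (move G a b D) + 2 ^ suc (exponent r a) ≡ potential r D + 2 ^ exponent r b
  potential-move r D a b 2≤Dₐ = trans (weightedSum-transfer _ D a b 1 2≤Dₐ)
    (cong (potential r D +_) (*-identityˡ (2 ^ exponent r b)))

  potential-move-≤ : ∀ r D → Adj G a b → 2 ≤ lookup D a → potential r (move G a b D) ≤ potential r D
  potential-move-≤ {a} {b} r D a~b 2≤Dₐ = +-cancelʳ-≤ (2 ^ suc (exponent r a)) _ _ (begin
    potential r (move G a b D) + 2 ^ suc (exponent r a) ≡⟨ potential-move r D a b 2≤Dₐ ⟩
    potential r D + 2 ^ exponent r b                   ≤⟨ +-monoʳ-≤ _ (^-monoʳ-≤ 2 (exponent-step a~b)) ⟩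
    potential r D + 2 ^ suc (exponent r a)             ∎)
    where open ≤-Reasoning

  potential-move-< : ∀ r D → dist G a r ≤ dist G b r → 2 ≤ lookup D a →
                     potential r (move G a b D) < potential r D
  potential-move-< {a} {b} r D a≤b 2≤Dₐ = +-cancelʳ-< (2 ^ exponent r a) _ _ (begin-strict
    potential r (move G a b D) + 2 ^ exponent r a
      <⟨ +-monoʳ-< (potential r (move G a b D)) (^-monoʳ-< 2 (s≤s (s≤s z≤n)) (n<1+n (exponent r a))) ⟩
    potential r (move G a b D) + 2 ^ suc (exponent r a)
      ≡⟨ potential-move r D a b 2≤Dₐ ⟩
    potential r D + 2 ^ exponent r b
      ≤⟨ +-monoʳ-≤ _ (^-monoʳ-≤ 2 (exponent-nongreedy a≤b)) ⟩
    potential r D + 2 ^ exponent r a ∎)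
    where open ≤-Reasoning

  solvable⇒2^n≤potential : Solvable G greedyOnly r D → 2 ^ n ≤ potential r D
  solvable⇒2^n≤potential {r = r} {D} (done 1≤Dᵣ) = begin
    2 ^ n                           ≡⟨ cong (2 ^_) exponent-root ⟨
    2 ^ exponent r r                ≤⟨ m≤n*m _ (lookup D r) {{>-nonZero 1≤Dᵣ}} ⟩
    lookup D r * 2 ^ exponent r r   ≤⟨ lookup*≤weightedSum _ D r ⟩
    potential r D                   ∎
    where open ≤-Reasoning
  solvable⇒2^n≤potential {r = r} {D} (step a b a~b 2≤Dₐ _ s) =
    ≤-trans (solvable⇒2^n≤potential s) (potential-move-≤ r D a~b 2≤Dₐ)

  potential≤2^n⇒greedy : RSolvable G r D → potential r D ≤ 2 ^ n → Greedy G r D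
  potential≤2^n⇒greedy (done 1≤Dᵣ) _ = done 1≤Dᵣ
  potential≤2^n⇒greedy {r} {D} (step a b a~b 2≤Dₐ _ s) pot≤ with dist G b r <? dist G a r
  ... | yes b<a = step a b a~b 2≤Dₐ (λ _ → b<a)
                    (potential≤2^n⇒greedy s (≤-trans (potential-move-≤ r D a~b 2≤Dₐ) pot≤))
  ... | no  b≮a = ⊥-elim (<⇒≱ (<-≤-trans (potential-move-< r D (≮⇒≥ b≮a) 2≤Dₐ) pot≤)
                                (solvable⇒2^n≤potential s))

  -- Greedy solutions and critical distributions

  pebbleAt : Fin n → Distribution G
  pebbleAt r = replicate n 0 [ r ]%= suc

  lookup-pebbleAt : lookup (pebbleAt r) r ≡ 1
  lookup-pebbleAt {r} = trans (lookup∘updateAt r (replicate n 0)) (cong suc (lookup-replicate r 0))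

  pebbleAt-≤ᵥ : 1 ≤ lookup D r → pebbleAt r ≤ᵥ D
  pebbleAt-≤ᵥ {D} {r} 1≤Dᵣ = ≤ᵥ-cases {i = r} {r} at-r at-r
    (λ v v≢r _ → ≤-trans (≤-reflexive (trans (lookup∘updateAt′ v r v≢r (replicate n 0)) (lookup-replicate v 0)))
                         z≤n)
    where
    at-r : lookup (pebbleAt r) r ≤ lookup D r
    at-r = subst (_≤ lookup D r) (sym lookup-pebbleAt) 1≤Dᵣ

  potential-pebbleAt : potential r (pebbleAt r) ≡ 2 ^ n
  potential-pebbleAt {r} = begin
    potential r (pebbleAt r)
      ≡⟨ weightedSum-updateAt-+ _ (replicate n 0) r 1 ⟩
    1 * 2 ^ exponent r r + potential r (replicate n 0)
      ≡⟨ cong₂ _+_ (*-identityˡ _) (weightedSum-replicate-0 {n} _) ⟩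
    2 ^ exponent r r + 0 ≡⟨ +-identityʳ _ ⟩
    2 ^ exponent r r     ≡⟨ cong (2 ^_) exponent-root ⟩
    2 ^ n                ∎
    where open ≡-Reasoning

  unmove : Fin n → Fin n → Distribution G → Distribution G
  unmove a b E = E [ b ]%= (_∸ 1) [ a ]%= (2 +_)

  lookup-unmove-src : ∀ E → Adj G a b → lookup (unmove a b E) a ≡ 2 + lookup E a
  lookup-unmove-src E a~b = lookup∘updateAt₂ʳ (adj⇒≢ a~b ∘ sym) (_∸ 1) (2 +_) E

  lookup-unmove-tgt : ∀ E → Adj G a b → lookup (unmove a b E) b ≡ lookup E b ∸ 1
  lookup-unmove-tgt E a~b = lookup∘updateAt₂ˡ (adj⇒≢ a~b ∘ sym) (_∸ 1) (2 +_) E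

  unmove-≤ᵥ : Adj G a b → 2 ≤ lookup D a → E ≤ᵥ move G a b D → unmove a b E ≤ᵥ D
  unmove-≤ᵥ {a} {b} {D} {E} a~b 2≤Dₐ (ext E≤D′) = ≤ᵥ-cases {i = a} {b}
    (begin
      lookup (unmove a b E) a ≡⟨ lookup-unmove-src E a~b ⟩
      2 + lookup E a          ≤⟨ +-monoʳ-≤ 2 (≤-trans (E≤D′ a) (≤-reflexive (lookup-move-src D a~b))) ⟩
      2 + (lookup D a ∸ 2)    ≡⟨ m+[n∸m]≡n 2≤Dₐ ⟩
      lookup D a              ∎)
    (begin
      lookup (unmove a b E) b ≡⟨ lookup-unmove-tgt E a~b ⟩
      lookup E b ∸ 1          ≤⟨ ∸-monoˡ-≤ 1 (≤-trans (E≤D′ b) (≤-reflexive (lookup-move-tgt D a~b))) ⟩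
      lookup D b              ∎)
    (λ v v≢a v≢b → begin
      lookup (unmove a b E) v ≡⟨ lookup∘updateAt₂′ E v≢b v≢a ⟩
      lookup E v              ≤⟨ E≤D′ v ⟩
      lookup (move G a b D) v ≡⟨ lookup-move-other D v≢a v≢b ⟩
      lookup D v              ∎)
    where open ≤-Reasoning

  ≤ᵥ-move-unmove : Adj G a b → E ≤ᵥ move G a b (unmove a b E)
  ≤ᵥ-move-unmove {a} {b} {E} a~b = ≤ᵥ-cases {i = a} {b}
    (≤-reflexive (sym (trans (lookup-move-src (unmove a b E) a~b) (cong (_∸ 2) (lookup-unmove-src E a~b)))))
    (≤-trans (m≤n+m∸n (lookup E b) 1)
      (≤-reflexive (sym (trans (lookup-move-tgt (unmove a b E) a~b) (cong suc (lookup-unmove-tgt E a~b))))))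
    (λ v v≢a v≢b →
      ≤-reflexive (sym (trans (lookup-move-other (unmove a b E) v≢a v≢b) (lookup∘updateAt₂′ E v≢b v≢a))))

  potential-unmove-≤ : ∀ r E → dist G b r < dist G a r → 1 ≤ lookup E b →
                       potential r (unmove a b E) ≤ potential r E
  potential-unmove-≤ {b} {a} r E b<a 1≤E_b = +-cancelʳ-≤ (1 * 2 ^ exponent r b) _ _ (begin
    potential r (unmove a b E) + 1 * 2 ^ exponent r b ≡⟨ weightedSum-transfer _ E b a 2 1≤E_b ⟩
    potential r E + 2 ^ suc (exponent r a)            ≤⟨ +-monoʳ-≤ _ (^-monoʳ-≤ 2 (exponent-greedy b<a)) ⟩
    potential r E + 2 ^ exponent r b                  ≡⟨ cong (potential r E +_) (*-identityˡ _) ⟨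
    potential r E + 1 * 2 ^ exponent r b              ∎)
    where open ≤-Reasoning

  ≤ᵥ-move∧tgt≡0⇒≤ᵥ : Adj G a b → E ≤ᵥ move G a b D → lookup E b ≡ 0 → E ≤ᵥ D
  ≤ᵥ-move∧tgt≡0⇒≤ᵥ {a} {b} {E} {D} a~b (ext E≤D′) E_b≡0 = ≤ᵥ-cases {i = a} {b}
    (≤-trans (E≤D′ a) (≤-trans (≤-reflexive (lookup-move-src D a~b)) (m∸n≤m _ 2)))
    (≤-trans (≤-reflexive E_b≡0) z≤n)
    (λ v v≢a v≢b → ≤-trans (E≤D′ v) (≤-reflexive (lookup-move-other D v≢a v≢b)))

  greedy⇒solvable-part-of-potential≤2^n : Greedy G r D →
    Σ (Distribution G) λ D′ → D′ ≤ᵥ D × RSolvable G r D′ × potential r D′ ≤ 2 ^ n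
  greedy⇒solvable-part-of-potential≤2^n {r} (done 1≤Dᵣ) =
    pebbleAt r , pebbleAt-≤ᵥ 1≤Dᵣ , done (≤-reflexive (sym lookup-pebbleAt)) , ≤-reflexive potential-pebbleAt
  greedy⇒solvable-part-of-potential≤2^n {r} (step a b a~b 2≤Dₐ greedy s) with greedy⇒solvable-part-of-potential≤2^n s
  ... | E , E≤D′ , solvableE , potentialE with 1 ≤? lookup E b
  ...   | no  E_b≢0 = E , ≤ᵥ-move∧tgt≡0⇒≤ᵥ a~b E≤D′ (n≤0⇒n≡0 (≮⇒≥ E_b≢0)) , solvableE , potentialE
  ...   | yes 1≤E_b =
    unmove a b E , unmove-≤ᵥ a~b 2≤Dₐ E≤D′ ,
    step a b a~b (≤-trans (m≤m+n 2 _) (≤-reflexive (sym (lookup-unmove-src E a~b)))) (λ ())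
      (solvable-mono (≤ᵥ-move-unmove a~b) solvableE) ,
    ≤-trans (potential-unmove-≤ r E (greedy _) 1≤E_b) potentialE

  ≤ᵥ-removePebble : ∀ {v} → E ≤ᵥ D → lookup E v < lookup D v → E ≤ᵥ removePebble G v D
  ≤ᵥ-removePebble {E} {D} {v} (ext E≤D) Eᵥ<Dᵥ = ≤ᵥ-cases {i = v} {v} at-v at-v
    (λ u u≢v _ → ≤-trans (E≤D u) (≤-reflexive (sym (lookup∘updateAt′ u v u≢v D))))
    where
    at-v : lookup E v ≤ lookup (removePebble G v D) v
    at-v = ≤-trans (∸-monoˡ-≤ 1 Eᵥ<Dᵥ) (≤-reflexive (sym (lookup∘updateAt v D)))

  critical⇒minimal : Critical G r D → E ≤ᵥ D → RSolvable G r E → D ≤ᵥ E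
  critical⇒minimal {D = D} {E} (_ , critical) E≤D solvableE = ext minimal
    where
    minimal : ∀ v → lookup D v ≤ lookup E v
    minimal v with lookup D v ≤? lookup E v
    ... | yes Dᵥ≤Eᵥ = Dᵥ≤Eᵥ
    ... | no  Dᵥ≰Eᵥ = ⊥-elim (critical v (≤-trans (s≤s z≤n) Eᵥ<Dᵥ)
                               (solvable-mono (≤ᵥ-removePebble E≤D Eᵥ<Dᵥ) solvableE))
      where
      Eᵥ<Dᵥ : lookup E v < lookup D v
      Eᵥ<Dᵥ = ≰⇒> Dᵥ≰Eᵥ

  critical-greedy⇒potential≤2^n : Critical G r D → Greedy G r D → potential r D ≤ 2 ^ n
  critical-greedy⇒potential≤2^n critical greedy with greedy⇒solvable-part-of-potential≤2^n greedy
  ... | E , E≤D , solvableE , potentialE =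
    ≤-trans (weightedSum-mono _ (critical⇒minimal critical E≤D solvableE)) potentialE

  removePebble-potential< : ∀ r D {v} → 1 ≤ lookup D v → potential r (removePebble G v D) < potential r D
  removePebble-potential< r D {v} 1≤Dᵥ = begin-strict
    potential r (removePebble G v D)
      <⟨ m<n+m _ (m^n>0 2 (exponent r v)) ⟩
    2 ^ exponent r v + potential r (removePebble G v D)
      ≡⟨ cong (_+ potential r (removePebble G v D)) (*-identityˡ (2 ^ exponent r v)) ⟨
    1 * 2 ^ exponent r v + potential r (removePebble G v D)
      ≡⟨ weightedSum-updateAt-∸ _ D v 1≤Dᵥ ⟩
    potential r D ∎
    where open ≤-Reasoning

  pebbleAt-critical : ∀ r → Critical G r (pebbleAt r)
  pebbleAt-critical r = done (≤-reflexive (sym lookup-pebbleAt)) , λ v 1≤ solvable →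
    <⇒≱ (<-≤-trans (removePebble-potential< r (pebbleAt r) 1≤) (≤-reflexive potential-pebbleAt))
        (solvable⇒2^n≤potential solvable)

  -- Deciding criticality, and the existence of ceiling distributions

  pebbleCount : Distribution G → ℕ
  pebbleCount = weightedSum (λ _ → 1)

  pebbleCount-move : ∀ D → 2 ≤ lookup D a → pebbleCount (move G a b D) < pebbleCount D
  pebbleCount-move {a} {b} D 2≤Dₐ = +-cancelʳ-< 1 _ _ (begin-strict
    pebbleCount (move G a b D) + 1 <⟨ +-monoʳ-< _ (n<1+n 1) ⟩
    pebbleCount (move G a b D) + 2 ≡⟨ weightedSum-transfer _ D a b 1 2≤Dₐ ⟩
    pebbleCount D + 1              ∎)
    where open ≤-Reasoning

  solvable-below? : ∀ r k D → pebbleCount D < k → Dec (RSolvable G r D)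
  solvable-below? r (suc k) D count<k with 1 ≤? lookup D r
  ... | yes 1≤Dᵣ = yes (done 1≤Dᵣ)
  ... | no  1≰Dᵣ = map′ (λ (a , b , a~b , 2≤Dₐ , s) → step a b a~b 2≤Dₐ (λ ()) s) first-move
                        (any? λ a → any? λ b → first-move? a b)
    where
    first-move : RSolvable G r D →
                 Σ (Fin n) λ a → Σ (Fin n) λ b → Adj G a b × 2 ≤ lookup D a × RSolvable G r (move G a b D)
    first-move (done 1≤Dᵣ) = ⊥-elim (1≰Dᵣ 1≤Dᵣ)
    first-move (step a b a~b 2≤Dₐ _ s) = a , b , a~b , 2≤Dₐ , s

    first-move? : ∀ a b → Dec (Adj G a b × 2 ≤ lookup D a × RSolvable G r (move G a b D))
    first-move? a b with T? (Graph.adj G a b) | 2 ≤? lookup D a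
    ... | no ¬a~b | _        = no (¬a~b ∘ proj₁)
    ... | yes _   | no 2≰Dₐ  = no (2≰Dₐ ∘ proj₁ ∘ proj₂)
    ... | yes a~b | yes 2≤Dₐ = map′ (λ s → a~b , 2≤Dₐ , s) (proj₂ ∘ proj₂)
      (solvable-below? r k (move G a b D) (<-≤-trans (pebbleCount-move D 2≤Dₐ) (s≤s⁻¹ count<k)))

  solvable? : ∀ r D → Dec (RSolvable G r D)
  solvable? r D = solvable-below? r _ D (n<1+n (pebbleCount D))

  critical? : ∀ r D → Dec (Critical G r D)
  critical? r D =
    solvable? r D ×-dec all? λ v → 1 ≤? lookup D v →-dec ¬? (solvable? r (removePebble G v D))

  length : ∀ {u v} → Walk G u v → ℕ
  length []      = 0
  length (_ ∷ w) = suc (length w)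

  push-along : Adj G a b → ∀ k D → 2 * k ≤ lookup D a →
               (∀ E → lookup D b + k ≤ lookup E b → RSolvable G r E) → RSolvable G r D
  push-along a~b zero    D _      solve = solve D (≤-reflexive (+-identityʳ _))
  push-along {a} {b} a~b (suc k) D 2k+2≤Dₐ solve =
    step a b a~b (≤-trans (m≤m+n 2 (2 * k)) 2k+2≤Dₐ′) (λ ())
      (push-along a~b k (move G a b D) 2k≤D′ₐ λ E D′_b+k≤E_b →
        solve E (≤-trans (≤-reflexive (trans (+-suc _ k) (cong (_+ k) (sym (lookup-move-tgt D a~b)))))
                         D′_b+k≤E_b))
    where
    2k+2≤Dₐ′ : 2 + 2 * k ≤ lookup D a
    2k+2≤Dₐ′ = ≤-trans (≤-reflexive (sym (*-suc 2 k))) 2k+2≤Dₐ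
    2k≤D′ₐ : 2 * k ≤ lookup (move G a b D) a
    2k≤D′ₐ = ≤-trans (≤-reflexive (sym (m+n∸m≡n 2 (2 * k))))
               (≤-trans (∸-monoˡ-≤ 2 2k+2≤Dₐ′) (≤-reflexive (sym (lookup-move-src D a~b))))

  walk-solvable : ∀ {u} (w : Walk G u r) D → 2 ^ length w ≤ lookup D u → RSolvable G r D
  walk-solvable []        D 1≤Dᵣ = done 1≤Dᵣ
  walk-solvable (u~x ∷ w) D 2^ℓ≤Dᵤ = push-along u~x (2 ^ length w) D 2^ℓ≤Dᵤ
    λ E D_x+2^ℓ≤E_x → walk-solvable w E (≤-trans (m≤n+m _ _) D_x+2^ℓ≤E_x)

  critical-≤-walk : ∀ {v} (w : Walk G v r) → Critical G r D → lookup D v ≤ 2 ^ length w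
  critical-≤-walk {D = D} {v} w (_ , critical) with lookup D v ≤? 2 ^ length w
  ... | yes Dᵥ≤2^ℓ = Dᵥ≤2^ℓ
  ... | no  Dᵥ≰2^ℓ = ⊥-elim (critical v (≤-trans (s≤s z≤n) 2^ℓ<Dᵥ)
                      (walk-solvable w (removePebble G v D)
                        (≤-trans (∸-monoˡ-≤ 1 2^ℓ<Dᵥ) (≤-reflexive (sym (lookup∘updateAt v D))))))
    where
    2^ℓ<Dᵥ : 2 ^ length w < lookup D v
    2^ℓ<Dᵥ = ≰⇒> Dᵥ≰2^ℓ

  module _ (connected : Connected G) where
    private
      root : Fin n
      root = proj₁ connected
      walk : ∀ u v → Walk G u v
      walk = proj₂ connected

    walkBound : Fin n → Distribution G
    walkBound r = tabulate λ v → 2 ^ length (walk v r)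

    rootedCandidates : List (Fin n × Distribution G)
    rootedCandidates = List.concatMap (λ r → List.map (r ,_) (boundedVecs (walkBound r))) (List.allFin n)

    critical∈rootedCandidates : Critical G r D → (r , D) ∈ rootedCandidates
    critical∈rootedCandidates {r} {D} critical = ∈-concat⁺′
      (∈-map⁺ (r ,_) (∈-boundedVecs {B = walkBound r} (ext λ v →
        subst (lookup D v ≤_) (sym (lookup∘tabulate _ v)) (critical-≤-walk (walk v r) critical))))
      (∈-map⁺ (λ r → List.map (r ,_) (boundedVecs (walkBound r))) (∈-allFin r))

    rootedCritical? : ∀ (x : Fin n × Distribution G) → Dec (Critical G (proj₁ x) (proj₂ x))
    rootedCritical? (r , D) = critical? r D

    criticalCandidates : List (Fin n × Distribution G)
    criticalCandidates = List.filter rootedCritical? rootedCandidates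

    ceiling-exists : Σ (Fin n) λ r → Σ (Distribution G) λ D → Ceiling G r D
    ceiling-exists = r* , D* , is-critical , is-maximal
      where
      largest : Fin n × Distribution G
      largest = argmax (size G ∘ proj₂) (root , pebbleAt root) criticalCandidates
      r* : Fin n
      r* = proj₁ largest
      D* : Distribution G
      D* = proj₂ largest
      is-critical : Critical G r* D*
      is-critical = argmax-all (size G ∘ proj₂) {P = λ (r , D) → Critical G r D}
        (pebbleAt-critical root) (all-filter rootedCritical? rootedCandidates)
      is-maximal : ∀ r D → Critical G r D → size G D ≤ size G D*
      is-maximal r D critical = All.lookup (f[xs]≤f[argmax] (root , pebbleAt root) criticalCandidates)
        (∈-filter⁺ rootedCritical? (critical∈rootedCandidates critical) critical)

theorem14 : (G : Graph) → Connected G → (Thrifty G ⇔ WeightOfGraphIs G 1ℚ)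
theorem14 G connected = mk⇔ thrifty⇒weight≡1 weight≡1⇒thrifty
  where
  open Graph G using (n)
  open Pebbling G

  ceiling-potential≤2^n : Thrifty G → ∀ r D → Ceiling G r D → potential r D ≤ 2 ^ n
  ceiling-potential≤2^n thrifty r D ceiling =
    critical-greedy⇒potential≤2^n (proj₁ ceiling) (thrifty r D ceiling)

  ceiling-2^n≤potential : ∀ r D → Ceiling G r D → 2 ^ n ≤ potential r D
  ceiling-2^n≤potential r D ((solvable , _) , _) = solvable⇒2^n≤potential solvable

  thrifty⇒weight≡1 : Thrifty G → WeightOfGraphIs G 1ℚ
  thrifty⇒weight≡1 thrifty with ceiling-exists connected
  ... | r , D , ceiling =
    (r , D , ceiling , potential≡2^n⇒weight≡1 r D
      (≤-antisym (ceiling-potential≤2^n thrifty r D ceiling) (ceiling-2^n≤potential r D ceiling))) ,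
    λ r D ceiling → Equivalence.from (weight≤1⇔potential≤2^n r D) (ceiling-potential≤2^n thrifty r D ceiling)

  weight≡1⇒thrifty : WeightOfGraphIs G 1ℚ → Thrifty G
  weight≡1⇒thrifty (_ , weight≤1) r D ceiling@((solvable , _) , _) =
    potential≤2^n⇒greedy solvable (Equivalence.to (weight≤1⇔potential≤2^n r D) (weight≤1 r D ceiling))
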